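{- Let $1 \leq i \leq j \leq m/2$ be integers. Then $p_*\big((i,j)\big) = \Theta(i/m)$.
   Context: Fix $m\in\mathbb N$ and the universe of IDs $[m]=\{1,\dots,m\}$. An ID-generation algorithm $\mathcal A$ is a probability distribution over permutations of $[m]$: an instance draws a permutation and answers its $t$-th request with the $t$-th entry. For the demand profile $(i,j)$, two instances of $\mathcal A$ with independent randomness are run, the first receiving $i$ requests and the second $j$ requests; a collision occurs if their output sets intersect. $p_{\mathcal A}((i,j))$ is the collision probability and $p_*((i,j))=\min_{\mathcal A}p_{\mathcal A}((i,j))$ over all algorithms. $\Theta$ hides absolute constants independent of $i,j,m$.
   Formalization: Each ID-generation algorithm assigns rational probabilities to the permutations of $[m]$. -}

module Defs where

open import Data.Nat using (ℕ)
open import Data.Fin using (Fin)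
open import Data.Fin.Properties using (_≟_)
open import Data.Bool using (Bool; true; false; if_then_else_)
open import Data.List using (List; []; _∷_; take; allFin; map; foldr; concatMap)
open import Data.Bool.ListAction using (any)
open import Data.List.Relation.Binary.Permutation.Propositional using (_↭_)
open import Data.List.Relation.Unary.All using (All)
open import Data.Product using (Σ; _×_; _,_; proj₁; proj₂)
open import Data.Integer using (+_)
open import Data.Rational using (ℚ; 0ℚ; 1ℚ; _+_; _*_; _≤_; _/_)
open import Relation.Nullary.Decidable using (⌊_⌋)
open import Relation.Binary.PropositionalEquality using (_≡_)

ℕ→ℚ : ℕ → ℚ
ℕ→ℚ n = + n / 1

-- A permutation of [m] = {1..m} (here Fin m), written as the list of its
-- entries in order: a list that is a rearrangement of all of Fin m.
Perm : ℕ → Set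
Perm m = Σ (List (Fin m)) (λ l → l ↭ allFin m)

-- An ID-generation algorithm: a finitely supported probability distribution
-- over permutations, given as a list of (permutation, weight) pairs with
-- nonnegative rational weights summing to 1 (repeated entries are allowed
-- and simply add up).
sumℚ : List ℚ → ℚ
sumℚ = foldr _+_ 0ℚ

record Algorithm (m : ℕ) : Set where
  field
    support  : List (Perm m × ℚ)
    nonneg   : All (λ pw → 0ℚ ≤ proj₂ pw) support
    total    : sumℚ (map proj₂ support) ≡ 1ℚ
open Algorithm public

collides : ∀ {m} → Perm m → ℕ → Perm m → ℕ → Bool
collides σ i τ j =
  any (λ x → any (λ y → ⌊ x ≟ y ⌋) (take j (proj₁ τ))) (take i (proj₁ σ))

indicator : Bool → ℚ
indicator true  = 1ℚ
indicator false = 0ℚ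

-- p_A((i,j)): two independent runs of A, the first answering i requests,
-- the second j requests; probability that the output sets intersect.
collisionProb : ∀ {m} → Algorithm m → ℕ → ℕ → ℚ
collisionProb A i j =
  sumℚ (concatMap (λ s → map (λ t →
          proj₂ s * proj₂ t * indicator (collides (proj₁ s) i (proj₁ t) j))
        (support A)) (support A))

-- Lower bound: let load y be the probability that ID y is among the first i outputs of an
-- instance. The loads sum to i, so by Cauchy–Schwarz their squares sum to at least i²/m;
-- but the sum of squared loads is the expected number of IDs shared by the i-prefixes of two
-- independent instances, which is at most i times the collision probability.
-- Upper bound: cut [m] into K = ⌊(m − j)/i⌋ blocks of size i and a tail of size at least
-- j − i, and let permutation b list block b, then the tail, then everything else. The first
-- j outputs then stay inside block b and the tail, so two instances collide only when they
-- pick the same block; picking b uniformly gives collision probability at most 1/K ≤ 4i/m.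

module Submission where

module CollisionBounds where

  open import Defs
  open import Data.Bool using (Bool; true; false; T)
  open import Data.Bool.ListAction using (any)
  open import Data.Empty using (⊥-elim)
  open import Data.Fin as Fin using (Fin; toℕ)
  open import Data.Fin.Properties using (_≟_; toℕ-injective; toℕ<n; toℕ-fromℕ<)
  import Data.Integer as ℤ
  import Data.Integer.Properties as ℤP
  import Data.Integer.Solver as ℤSolver
  open import Data.List using (List; []; _∷_; _++_; map; concatMap; take; length; allFin; tabulate)
  import Data.List.Properties as List
  open import Data.List.Membership.Propositional using (_∈_; find)
  open import Data.List.Membership.Propositional.Properties using (∈-map⁻; ∈-++⁻)
  open import Data.List.Relation.Unary.All as All using (All)
  import Data.List.Relation.Unary.All.Properties as All
  open import Data.List.Relation.Unary.Any as Any using (here; there)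
  open import Data.List.Relation.Unary.Any.Properties using (any⁺; any⁻)
  open import Data.List.Relation.Unary.AllPairs using (_∷_)
  open import Data.List.Relation.Unary.Unique.Propositional using (Unique)
  import Data.List.Relation.Unary.Unique.Propositional.Properties as Unique
  open import Data.List.Relation.Binary.Permutation.Propositional using (_↭_; ↭-sym; ↭-trans; ↭-reflexive; ↭⇒↭ₛ)
  import Data.List.Relation.Binary.Permutation.Propositional.Properties as ↭
  import Data.List.Relation.Binary.Permutation.Setoid.Properties as ↭ₛ
  open import Data.Nat as ℕ using (ℕ; zero; suc; z≤n; s≤s; _∸_; NonZero)
  import Data.Nat.Properties as ℕP
  open import Data.Nat.DivMod using (_mod_; m<n⇒m%n≡m; m≡m%n+[m/n]*n; m%n<n; m/n*n≤m)
  import Data.Nat.Solver as ℕSolver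
  open import Data.Nat.Coprimality using (1-coprimeTo) renaming (sym to coprime-sym)
  open import Data.Product using (Σ; ∃; _×_; _,_; proj₁; proj₂)
  open import Data.Rational as ℚ using (ℚ; 0ℚ; 1ℚ; _+_; _*_; -_; _-_; _≤_; toℚᵘ)
  import Data.Rational.Properties as ℚP
  import Data.Rational.Solver as ℚSolver
  open import Data.Rational.Unnormalised as ℚᵘ using (mkℚᵘ; *≡*)
  import Data.Rational.Unnormalised.Properties as ℚᵘP
  open import Data.Sum using (_⊎_; inj₁; inj₂)
  open import Function using (_∘_; id)
  open import Relation.Nullary.Decidable using (yes; no; ⌊_⌋; toWitness; fromWitness)
  open import Relation.Binary.PropositionalEquality

  ℕ→ℚ-toℚᵘ : ∀ n → toℚᵘ (ℕ→ℚ n) ≡ mkℚᵘ (ℤ.+ n) 0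
  ℕ→ℚ-toℚᵘ n = cong toℚᵘ (ℚP.normalize-coprime (coprime-sym (1-coprimeTo n)))

  ℕ→ℚ-+ : ∀ a b → ℕ→ℚ (a ℕ.+ b) ≡ ℕ→ℚ a + ℕ→ℚ b
  ℕ→ℚ-+ a b = ℚP.toℚᵘ-injective (begin
    toℚᵘ (ℕ→ℚ (a ℕ.+ b))            ≡⟨ ℕ→ℚ-toℚᵘ (a ℕ.+ b) ⟩
    mkℚᵘ (ℤ.+ (a ℕ.+ b)) 0             ≈⟨ *≡* (trans (cong (ℤ._* ℤ.+ 1) (ℤP.pos-+ a b)) (denominators (ℤ.+ a) (ℤ.+ b))) ⟩
    mkℚᵘ (ℤ.+ a) 0 ℚᵘ.+ mkℚᵘ (ℤ.+ b) 0   ≡⟨ sym (cong₂ ℚᵘ._+_ (ℕ→ℚ-toℚᵘ a) (ℕ→ℚ-toℚᵘ b)) ⟩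
    toℚᵘ (ℕ→ℚ a) ℚᵘ.+ toℚᵘ (ℕ→ℚ b)  ≈⟨ ℚᵘP.≃-sym (ℚP.toℚᵘ-homo-+ (ℕ→ℚ a) (ℕ→ℚ b)) ⟩
    toℚᵘ (ℕ→ℚ a + ℕ→ℚ b)             ∎)
    where
    open ℚᵘP.≃-Reasoning
    open ℤSolver.+-*-Solver
    denominators : ∀ x y → (x ℤ.+ y) ℤ.* ℤ.+ 1 ≡ (x ℤ.* ℤ.+ 1 ℤ.+ y ℤ.* ℤ.+ 1) ℤ.* ℤ.+ 1
    denominators = solve 2 (λ x y → (x :+ y) :* con (ℤ.+ 1) := (x :* con (ℤ.+ 1) :+ y :* con (ℤ.+ 1)) :* con (ℤ.+ 1)) refl

  ℕ→ℚ-* : ∀ a b → ℕ→ℚ (a ℕ.* b) ≡ ℕ→ℚ a * ℕ→ℚ b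
  ℕ→ℚ-* a b = ℚP.toℚᵘ-injective (begin
    toℚᵘ (ℕ→ℚ (a ℕ.* b))            ≡⟨ ℕ→ℚ-toℚᵘ (a ℕ.* b) ⟩
    mkℚᵘ (ℤ.+ (a ℕ.* b)) 0             ≈⟨ *≡* (cong (ℤ._* ℤ.+ 1) (ℤP.pos-* a b)) ⟩
    mkℚᵘ (ℤ.+ a) 0 ℚᵘ.* mkℚᵘ (ℤ.+ b) 0   ≡⟨ sym (cong₂ ℚᵘ._*_ (ℕ→ℚ-toℚᵘ a) (ℕ→ℚ-toℚᵘ b)) ⟩
    toℚᵘ (ℕ→ℚ a) ℚᵘ.* toℚᵘ (ℕ→ℚ b)  ≈⟨ ℚᵘP.≃-sym (ℚP.toℚᵘ-homo-* (ℕ→ℚ a) (ℕ→ℚ b)) ⟩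
    toℚᵘ (ℕ→ℚ a * ℕ→ℚ b)             ∎)
    where open ℚᵘP.≃-Reasoning

  ℕ→ℚ-pos : ∀ n .{{_ : NonZero n}} → ℚ.Positive (ℕ→ℚ n)
  ℕ→ℚ-pos n = ℚP.normalize-pos n 1

  ℕ→ℚ-nonNeg : ∀ n → 0ℚ ≤ ℕ→ℚ n
  ℕ→ℚ-nonNeg n = ℚP.nonNegative⁻¹ _ {{ℚP.normalize-nonNeg n 1}}

  ℕ→ℚ-mono-≤ : ∀ {a b} → a ℕ.≤ b → ℕ→ℚ a ≤ ℕ→ℚ b
  ℕ→ℚ-mono-≤ {a} {b} a≤b = begin
    ℕ→ℚ a                        ≡⟨ ℚP.+-identityʳ (ℕ→ℚ a) ⟨
    ℕ→ℚ a + 0ℚ                   ≤⟨ ℚP.+-monoʳ-≤ (ℕ→ℚ a) (ℕ→ℚ-nonNeg (b ∸ a)) ⟩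
    ℕ→ℚ a + ℕ→ℚ (b ∸ a)          ≡⟨ ℕ→ℚ-+ a (b ∸ a) ⟨
    ℕ→ℚ (a ℕ.+ (b ∸ a))          ≡⟨ cong ℕ→ℚ (ℕP.m+[n∸m]≡n a≤b) ⟩
    ℕ→ℚ b                        ∎
    where open ℚP.≤-Reasoning

  *-nonNeg : ∀ {p q} → 0ℚ ≤ p → 0ℚ ≤ q → 0ℚ ≤ p * q
  *-nonNeg {p} {q} 0≤p 0≤q = ℚP.nonNegative⁻¹ (p * q)
    {{ℚP.nonNeg*nonNeg⇒nonNeg p {{ℚ.nonNegative 0≤p}} q {{ℚ.nonNegative 0≤q}}}}

  square-nonNeg : ∀ p → 0ℚ ≤ p * p
  square-nonNeg p with ℚP.≤-total 0ℚ p
  ... | inj₁ 0≤p = *-nonNeg 0≤p 0≤p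
  ... | inj₂ p≤0 = ℚP.nonNegative⁻¹ (p * p)
    {{ℚP.nonPos*nonPos⇒nonPos p {{ℚ.nonPositive p≤0}} p {{ℚ.nonPositive p≤0}}}}

  *-monoˡ-≤-0≤ : ∀ {r p q} → 0ℚ ≤ r → p ≤ q → r * p ≤ r * q
  *-monoˡ-≤-0≤ {r} 0≤r = ℚP.*-monoˡ-≤-nonNeg r {{ℚ.nonNegative 0≤r}}

  ∑ : {A : Set} → List A → (A → ℚ) → ℚ
  ∑ xs f = sumℚ (map f xs)

  syntax ∑ xs (λ x → e) = ∑[ x ← xs ] e

  module _ {A : Set} where

    ∑-cong : ∀ (xs : List A) {f g : A → ℚ} → (∀ x → f x ≡ g x) → ∑ xs f ≡ ∑ xs g
    ∑-cong xs f≗g = cong sumℚ (List.map-cong f≗g xs)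

    ∑-zero : ∀ (xs : List A) → ∑[ _ ← xs ] 0ℚ ≡ 0ℚ
    ∑-zero []       = refl
    ∑-zero (x ∷ xs) = trans (ℚP.+-identityˡ _) (∑-zero xs)

    ∑-+ : ∀ (xs : List A) (f g : A → ℚ) → ∑[ x ← xs ] (f x + g x) ≡ ∑ xs f + ∑ xs g
    ∑-+ []       f g = refl
    ∑-+ (x ∷ xs) f g = trans (cong (f x + g x +_) (∑-+ xs f g)) (interchange (f x) (g x) (∑ xs f) (∑ xs g))
      where
      open ℚSolver.+-*-Solver
      interchange : ∀ a b c d → a + b + (c + d) ≡ a + c + (b + d)
      interchange = solve 4 (λ a b c d → a :+ b :+ (c :+ d) := a :+ c :+ (b :+ d)) refl

    ∑-*ˡ : ∀ (xs : List A) c (f : A → ℚ) → ∑[ x ← xs ] (c * f x) ≡ c * ∑ xs f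
    ∑-*ˡ []       c f = sym (ℚP.*-zeroʳ c)
    ∑-*ˡ (x ∷ xs) c f = trans (cong (c * f x +_) (∑-*ˡ xs c f)) (sym (ℚP.*-distribˡ-+ c (f x) (∑ xs f)))

    ∑-*ʳ : ∀ (xs : List A) c (f : A → ℚ) → ∑[ x ← xs ] (f x * c) ≡ ∑ xs f * c
    ∑-*ʳ xs c f = trans (∑-cong xs (λ x → ℚP.*-comm (f x) c)) (trans (∑-*ˡ xs c f) (ℚP.*-comm c (∑ xs f)))

    ∑-const : ∀ (xs : List A) c → ∑[ _ ← xs ] c ≡ ℕ→ℚ (length xs) * c
    ∑-const []       c = sym (ℚP.*-zeroˡ c)
    ∑-const (x ∷ xs) c = begin
      c + ∑[ _ ← xs ] c                   ≡⟨ cong (c +_) (∑-const xs c) ⟩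
      c + ℕ→ℚ (length xs) * c             ≡⟨ cong (_+ ℕ→ℚ (length xs) * c) (ℚP.*-identityˡ c) ⟨
      1ℚ * c + ℕ→ℚ (length xs) * c        ≡⟨ ℚP.*-distribʳ-+ c 1ℚ (ℕ→ℚ (length xs)) ⟨
      (1ℚ + ℕ→ℚ (length xs)) * c          ≡⟨ cong (_* c) (ℕ→ℚ-+ 1 (length xs)) ⟨
      ℕ→ℚ (suc (length xs)) * c           ∎
      where open ≡-Reasoning

    ∑-mono-≤ : ∀ (xs : List A) {f g : A → ℚ} → (∀ {x} → x ∈ xs → f x ≤ g x) → ∑ xs f ≤ ∑ xs g
    ∑-mono-≤ []       f≤g = ℚP.≤-refl
    ∑-mono-≤ (x ∷ xs) f≤g = ℚP.+-mono-≤ (f≤g (here refl)) (∑-mono-≤ xs (f≤g ∘ there))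

    ∑-nonNeg : ∀ (xs : List A) {f : A → ℚ} → (∀ x → 0ℚ ≤ f x) → 0ℚ ≤ ∑ xs f
    ∑-nonNeg xs {f} 0≤f = subst (_≤ ∑ xs f) (∑-zero xs) (∑-mono-≤ xs (λ {x} _ → 0≤f x))

  module _ {A B : Set} where

    ∑-map : ∀ (xs : List A) (g : A → B) (f : B → ℚ) → ∑ (map g xs) f ≡ ∑ xs (f ∘ g)
    ∑-map xs g f = cong sumℚ (sym (List.map-∘ xs))

    ∑-comm : ∀ (xs : List A) (ys : List B) (f : A → B → ℚ) →
             ∑[ x ← xs ] ∑[ y ← ys ] f x y ≡ ∑[ y ← ys ] ∑[ x ← xs ] f x y
    ∑-comm []       ys f = sym (∑-zero ys)
    ∑-comm (x ∷ xs) ys f = trans (cong (∑ ys (f x) +_) (∑-comm xs ys f))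
                                 (sym (∑-+ ys (f x) (λ y → ∑[ x ← xs ] f x y)))

    ∑-*-∑ : ∀ (xs : List A) (ys : List B) (f : A → ℚ) (g : B → ℚ) →
            ∑ xs f * ∑ ys g ≡ ∑[ x ← xs ] ∑[ y ← ys ] (f x * g y)
    ∑-*-∑ xs ys f g = trans (sym (∑-*ʳ xs (∑ ys g) f)) (∑-cong xs (λ x → sym (∑-*ˡ ys (f x) g)))

    sumℚ-concatMap : ∀ (xs : List A) (ys : List B) (f : A → B → ℚ) →
                     sumℚ (concatMap (λ x → map (f x) ys) xs) ≡ ∑[ x ← xs ] ∑[ y ← ys ] f x y
    sumℚ-concatMap []       ys f = refl
    sumℚ-concatMap (x ∷ xs) ys f = begin
      sumℚ (map (f x) ys ++ concatMap (λ x → map (f x) ys) xs)      ≡⟨ sumℚ-++ (map (f x) ys) _ ⟩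
      ∑ ys (f x) + sumℚ (concatMap (λ x → map (f x) ys) xs)         ≡⟨ cong (∑ ys (f x) +_) (sumℚ-concatMap xs ys f) ⟩
      ∑ ys (f x) + ∑[ x ← xs ] ∑[ y ← ys ] f x y                     ∎
      where
      open ≡-Reasoning
      sumℚ-++ : ∀ (ps qs : List ℚ) → sumℚ (ps ++ qs) ≡ sumℚ ps + sumℚ qs
      sumℚ-++ []       qs = sym (ℚP.+-identityˡ (sumℚ qs))
      sumℚ-++ (p ∷ ps) qs = trans (cong (p +_) (sumℚ-++ ps qs)) (sym (ℚP.+-assoc p (sumℚ ps) (sumℚ qs)))

  length-allFin : ∀ n → length (allFin n) ≡ n
  length-allFin n = List.length-tabulate {n = n} id

  ∑-allFin-const : ∀ n c → ∑[ _ ← allFin n ] c ≡ ℕ→ℚ n * c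
  ∑-allFin-const n c = trans (∑-const (allFin n) c) (cong (λ k → ℕ→ℚ k * c) (length-allFin n))

  ∑-allFin-suc : ∀ {n} (f : Fin (suc n) → ℚ) → ∑ (allFin (suc n)) f ≡ f Fin.zero + ∑[ y ← allFin n ] f (Fin.suc y)
  ∑-allFin-suc f = cong (f Fin.zero +_) (cong sumℚ
    (trans (List.map-tabulate Fin.suc f) (sym (List.map-tabulate id (f ∘ Fin.suc)))))

  collisionProb-∑ : ∀ {m} (A : Algorithm m) i j → collisionProb A i j ≡
    ∑[ s ← support A ] ∑[ t ← support A ] (proj₂ s * proj₂ t * indicator (collides (proj₁ s) i (proj₁ t) j))
  collisionProb-∑ A i j = sumℚ-concatMap (support A) (support A) _

  ∑-square≤length*∑-squares : ∀ {A : Set} (xs : List A) (f : A → ℚ) →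
    ∑ xs f * ∑ xs f ≤ ℕ→ℚ (length xs) * ∑[ x ← xs ] (f x * f x)
  ∑-square≤length*∑-squares          []         f = ℚP.≤-refl
  ∑-square≤length*∑-squares {A = A} xs@(_ ∷ _) f = ℚP.*-cancelˡ-≤-pos n {{ℕ→ℚ-pos (length xs)}} (begin
    n * (S * S)                               ≡⟨ ℚP.+-identityʳ (n * (S * S)) ⟨
    n * (S * S) + 0ℚ                          ≤⟨ ℚP.+-monoʳ-≤ (n * (S * S)) (∑-nonNeg xs (λ x → square-nonNeg (n * f x - S))) ⟩
    n * (S * S) + ∑[ x ← xs ] deviation² x    ≡⟨ cong (n * (S * S) +_) ∑-deviation² ⟩
    n * (S * S) + (n * n * Q + (c * S + n * (S * S))) ≡⟨ collect n S Q ⟩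
    n * (n * Q)                               ∎)
    where
    open ℚP.≤-Reasoning
    open ℚSolver.+-*-Solver
    n S Q c : ℚ
    n = ℕ→ℚ (length xs)
    S = ∑ xs f
    Q = ∑[ x ← xs ] (f x * f x)
    c = - (S + S) * n

    deviation² : A → ℚ
    deviation² x = (n * f x - S) * (n * f x - S)

    expand : ∀ n S a → (n * a - S) * (n * a - S) ≡ n * n * (a * a) + (- (S + S) * n * a + S * S)
    expand = solve 3 (λ n S a → (n :* a :- S) :* (n :* a :- S)
                              := n :* n :* (a :* a) :+ (:- (S :+ S) :* n :* a :+ S :* S)) refl

    collect : ∀ n S Q → n * (S * S) + (n * n * Q + (- (S + S) * n * S + n * (S * S))) ≡ n * (n * Q)
    collect = solve 3 (λ n S Q → n :* (S :* S) :+ (n :* n :* Q :+ (:- (S :+ S) :* n :* S :+ n :* (S :* S)))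
                               := n :* (n :* Q)) refl

    ∑-deviation² : ∑[ x ← xs ] deviation² x ≡ n * n * Q + (c * S + n * (S * S))
    ∑-deviation² = begin-equality
      ∑[ x ← xs ] deviation² x                                      ≡⟨ ∑-cong xs (λ x → expand n S (f x)) ⟩
      ∑[ x ← xs ] (n * n * (f x * f x) + (c * f x + S * S))
        ≡⟨ ∑-+ xs (λ x → n * n * (f x * f x)) (λ x → c * f x + S * S) ⟩
      ∑[ x ← xs ] (n * n * (f x * f x)) + ∑[ x ← xs ] (c * f x + S * S)
        ≡⟨ cong₂ _+_ (∑-*ˡ xs (n * n) (λ x → f x * f x))
                     (trans (∑-+ xs (λ x → c * f x) (λ _ → S * S)) (cong₂ _+_ (∑-*ˡ xs c f) (∑-const xs (S * S)))) ⟩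
      n * n * Q + (c * S + n * (S * S))                             ∎

  indicator-nonNeg : ∀ b → 0ℚ ≤ indicator b
  indicator-nonNeg true  = ℚP.≤ᵇ⇒≤ _
  indicator-nonNeg false = ℚP.≤-refl

  indicator-mono : ∀ {a b} → (T a → T b) → indicator a ≤ indicator b
  indicator-mono {false} {b}     _   = indicator-nonNeg b
  indicator-mono {true}  {true}  _   = ℚP.≤-refl
  indicator-mono {true}  {false} a⇒b = ⊥-elim (a⇒b _)

  indicator-*-≤ : ∀ {a b c} → (T a → T b → T c) → indicator a * indicator b ≤ indicator c * indicator a
  indicator-*-≤ {true}  {true}  {false} abc = ⊥-elim (abc _ _)
  indicator-*-≤ {true}  {true}  {true}  _   = ℚP.≤ᵇ⇒≤ _
  indicator-*-≤ {true}  {false} {true}  _   = ℚP.≤ᵇ⇒≤ _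
  indicator-*-≤ {true}  {false} {false} _   = ℚP.≤ᵇ⇒≤ _
  indicator-*-≤ {false} {true}  {true}  _   = ℚP.≤ᵇ⇒≤ _
  indicator-*-≤ {false} {true}  {false} _   = ℚP.≤ᵇ⇒≤ _
  indicator-*-≤ {false} {false} {true}  _   = ℚP.≤ᵇ⇒≤ _
  indicator-*-≤ {false} {false} {false} _   = ℚP.≤ᵇ⇒≤ _

  -- collides σ i τ j unfolds to any (λ x → mem x (take j (proj₁ τ))) (take i (proj₁ σ)).
  mem : ∀ {m} → Fin m → List (Fin m) → Bool
  mem y xs = any (λ x → ⌊ y ≟ x ⌋) xs

  mem⁻ : ∀ {m} {y : Fin m} {xs} → T (mem y xs) → y ∈ xs
  mem⁻ {xs = xs} y∈?xs = Any.map toWitness (any⁻ _ xs y∈?xs)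

  mem⁺ : ∀ {m} {y : Fin m} {xs} → y ∈ xs → T (mem y xs)
  mem⁺ y∈xs = any⁺ _ (Any.map fromWitness y∈xs)

  collides⁺ : ∀ {m} {σ τ : Perm m} {i j x} →
              x ∈ take i (proj₁ σ) → x ∈ take j (proj₁ τ) → T (collides σ i τ j)
  collides⁺ x∈σ x∈τ = any⁺ _ (Any.map (λ { refl → mem⁺ x∈τ }) x∈σ)

  collides⁻ : ∀ {m} {σ τ : Perm m} {i j} → T (collides σ i τ j) →
              ∃ λ x → x ∈ take i (proj₁ σ) × x ∈ take j (proj₁ τ)
  collides⁻ {σ = σ} {i = i} col with x , x∈σ , x∈?τ ← find (any⁻ _ (take i (proj₁ σ)) col) = x , x∈σ , mem⁻ x∈?τ

  ∑-indicator-≟ : ∀ {n} (x : Fin n) → ∑[ y ← allFin n ] indicator ⌊ y ≟ x ⌋ ≡ 1ℚ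
  ∑-indicator-≟ {suc n} Fin.zero = begin
    ∑[ y ← allFin (suc n) ] indicator ⌊ y ≟ Fin.zero ⌋  ≡⟨ ∑-allFin-suc {n} (λ y → indicator ⌊ y ≟ Fin.zero ⌋) ⟩
    1ℚ + ∑[ _ ← allFin n ] 0ℚ                           ≡⟨ cong (1ℚ +_) (∑-zero (allFin n)) ⟩
    1ℚ + 0ℚ                                              ≡⟨ ℚP.+-identityʳ 1ℚ ⟩
    1ℚ                                                   ∎
    where open ≡-Reasoning
  ∑-indicator-≟ {suc n} (Fin.suc x) = begin
    ∑[ y ← allFin (suc n) ] indicator ⌊ y ≟ Fin.suc x ⌋      ≡⟨ ∑-allFin-suc {n} (λ y → indicator ⌊ y ≟ Fin.suc x ⌋) ⟩
    0ℚ + ∑[ y ← allFin n ] indicator ⌊ Fin.suc y ≟ Fin.suc x ⌋ ≡⟨ ℚP.+-identityˡ _ ⟩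
    ∑[ y ← allFin n ] indicator ⌊ Fin.suc y ≟ Fin.suc x ⌋      ≡⟨ ∑-cong (allFin n) (λ y → cong indicator (suc≟suc y)) ⟩
    ∑[ y ← allFin n ] indicator ⌊ y ≟ x ⌋                      ≡⟨ ∑-indicator-≟ x ⟩
    1ℚ                                                         ∎
    where
    open ≡-Reasoning
    suc≟suc : ∀ y → ⌊ Fin.suc y ≟ Fin.suc x ⌋ ≡ ⌊ y ≟ x ⌋
    suc≟suc y with y ≟ x
    ... | yes _ = refl
    ... | no  _ = refl

  ∑-indicator-mem : ∀ {m} (xs : List (Fin m)) → Unique xs →
                    ∑[ y ← allFin m ] indicator (mem y xs) ≡ ℕ→ℚ (length xs)
  ∑-indicator-mem {m} []       _              = ∑-zero (allFin m)
  ∑-indicator-mem {m} (x ∷ xs) (x∉xs ∷ !xs) = begin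
    ∑[ y ← allFin m ] indicator (mem y (x ∷ xs))                        ≡⟨ ∑-cong (allFin m) split ⟩
    ∑[ y ← allFin m ] (indicator ⌊ y ≟ x ⌋ + indicator (mem y xs))      ≡⟨ ∑-+ (allFin m) _ _ ⟩
    ∑[ y ← allFin m ] indicator ⌊ y ≟ x ⌋ + ∑[ y ← allFin m ] indicator (mem y xs)
                                                                         ≡⟨ cong₂ _+_ (∑-indicator-≟ x) (∑-indicator-mem xs !xs) ⟩
    1ℚ + ℕ→ℚ (length xs)                                                ≡⟨ ℕ→ℚ-+ 1 (length xs) ⟨
    ℕ→ℚ (length (x ∷ xs))                                               ∎
    where
    open ≡-Reasoning
    split : ∀ y → indicator (mem y (x ∷ xs)) ≡ indicator ⌊ y ≟ x ⌋ + indicator (mem y xs)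
    split y with y ≟ x | mem y xs in y∈?xs
    ... | no  _    | b     = sym (ℚP.+-identityˡ (indicator b))
    ... | yes refl | false = sym (ℚP.+-identityʳ 1ℚ)
    ... | yes refl | true  = ⊥-elim (All.lookup x∉xs (mem⁻ (subst T (sym y∈?xs) _)) refl)

  ∈-take-mono : ∀ {A : Set} {x : A} {n n′} (xs : List A) → n ℕ.≤ n′ → x ∈ take n xs → x ∈ take n′ xs
  ∈-take-mono {n = zero}  xs       _          ()
  ∈-take-mono {n = suc _} []       _          ()
  ∈-take-mono             (y ∷ ys) (s≤s n≤n′) (here x≡y)  = here x≡y
  ∈-take-mono             (y ∷ ys) (s≤s n≤n′) (there x∈ys) = there (∈-take-mono ys n≤n′ x∈ys)

  ∈-take-++⁻ : ∀ {A : Set} {x : A} {n} (xs ys : List A) → n ℕ.≤ length xs → x ∈ take n (xs ++ ys) → x ∈ xs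
  ∈-take-++⁻ {n = zero}  xs       ys _          ()
  ∈-take-++⁻ {n = suc _} (z ∷ zs) ys _          (here x≡z)   = here x≡z
  ∈-take-++⁻ {n = suc _} (z ∷ zs) ys (s≤s n≤∣zs∣) (there x∈zs) = there (∈-take-++⁻ zs ys n≤∣zs∣ x∈zs)

  Perm-unique : ∀ {m} (σ : Perm m) → Unique (proj₁ σ)
  Perm-unique {m} (xs , xs↭allFin) =
    ↭ₛ.Unique-resp-↭ (setoid (Fin m)) (↭⇒↭ₛ (↭-sym xs↭allFin)) (Unique.allFin⁺ m)

  Perm-length : ∀ {m} (σ : Perm m) → length (proj₁ σ) ≡ m
  Perm-length {m} (xs , xs↭allFin) = trans (↭.↭-length xs↭allFin) (length-allFin m)

  length-take-Perm : ∀ {m i} (σ : Perm m) → i ℕ.≤ m → length (take i (proj₁ σ)) ≡ i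
  length-take-Perm {m} {i} σ i≤m = begin
    length (take i (proj₁ σ))     ≡⟨ List.length-take i (proj₁ σ) ⟩
    i ℕ.⊓ length (proj₁ σ)       ≡⟨ cong (i ℕ.⊓_) (Perm-length σ) ⟩
    i ℕ.⊓ m                      ≡⟨ ℕP.m≤n⇒m⊓n≡m i≤m ⟩
    i                            ∎
    where open ≡-Reasoning

  -- The lower bound

  module LowerBound {m : ℕ} (A : Algorithm m) {i j : ℕ} (i≤j : i ℕ.≤ j) (i≤m : i ℕ.≤ m) where

    weight : Perm m × ℚ → ℚ
    weight = proj₂

    hits : Perm m × ℚ → Fin m → ℚ
    hits s y = indicator (mem y (take i (proj₁ (proj₁ s))))

    load : Fin m → ℚ
    load y = ∑[ s ← support A ] (weight s * hits s y)

    ∑-hits : ∀ s → ∑[ y ← allFin m ] hits s y ≡ ℕ→ℚ i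
    ∑-hits (σ , _) = trans (∑-indicator-mem (take i (proj₁ σ)) (Unique.take⁺ i (Perm-unique σ)))
                           (cong ℕ→ℚ (length-take-Perm σ i≤m))

    ∑-load : ∑[ y ← allFin m ] load y ≡ ℕ→ℚ i
    ∑-load = begin
      ∑[ y ← allFin m ] ∑[ s ← support A ] (weight s * hits s y)
        ≡⟨ ∑-comm (allFin m) (support A) (λ y s → weight s * hits s y) ⟩
      ∑[ s ← support A ] ∑[ y ← allFin m ] (weight s * hits s y)
        ≡⟨ ∑-cong (support A) (λ s → trans (∑-*ˡ (allFin m) (weight s) (hits s)) (cong (weight s *_) (∑-hits s))) ⟩
      ∑[ s ← support A ] (weight s * ℕ→ℚ i)   ≡⟨ ∑-*ʳ (support A) (ℕ→ℚ i) weight ⟩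
      ∑ (support A) weight * ℕ→ℚ i             ≡⟨ cong (_* ℕ→ℚ i) (total A) ⟩
      1ℚ * ℕ→ℚ i                              ≡⟨ ℚP.*-identityˡ (ℕ→ℚ i) ⟩
      ℕ→ℚ i                                   ∎
      where open ≡-Reasoning

    shared : Perm m × ℚ → Perm m × ℚ → ℚ
    shared s t = ∑[ y ← allFin m ] (hits s y * hits t y)

    ∑-load² : ∑[ y ← allFin m ] (load y * load y) ≡
              ∑[ s ← support A ] ∑[ t ← support A ] (weight s * weight t * shared s t)
    ∑-load² = begin
      ∑[ y ← allFin m ] (load y * load y)
        ≡⟨ ∑-cong (allFin m) (λ y → ∑-*-∑ (support A) (support A) (λ s → weight s * hits s y) (λ t → weight t * hits t y)) ⟩
      ∑[ y ← allFin m ] ∑[ s ← support A ] ∑[ t ← support A ] (weight s * hits s y * (weight t * hits t y))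
        ≡⟨ ∑-comm (allFin m) (support A) _ ⟩
      ∑[ s ← support A ] ∑[ y ← allFin m ] ∑[ t ← support A ] (weight s * hits s y * (weight t * hits t y))
        ≡⟨ ∑-cong (support A) (λ s → ∑-comm (allFin m) (support A) _) ⟩
      ∑[ s ← support A ] ∑[ t ← support A ] ∑[ y ← allFin m ] (weight s * hits s y * (weight t * hits t y))
        ≡⟨ ∑-cong (support A) (λ s → ∑-cong (support A) (λ t →
             trans (∑-cong (allFin m) (λ y → regroup (weight s) (hits s y) (weight t) (hits t y)))
                   (∑-*ˡ (allFin m) (weight s * weight t) (λ y → hits s y * hits t y)))) ⟩
      ∑[ s ← support A ] ∑[ t ← support A ] (weight s * weight t * shared s t)     ∎
      where
      open ≡-Reasoning
      open ℚSolver.+-*-Solver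
      regroup : ∀ a b c d → a * b * (c * d) ≡ a * c * (b * d)
      regroup = solve 4 (λ a b c d → a :* b :* (c :* d) := a :* c :* (b :* d)) refl

    col : Perm m × ℚ → Perm m × ℚ → ℚ
    col s t = indicator (collides (proj₁ s) i (proj₁ t) j)

    -- The i-prefix of t lies in its j-prefix, so an ID shared by the i-prefixes is a collision.
    shared≤ : ∀ s t → shared s t ≤ col s t * ℕ→ℚ i
    shared≤ s t = begin
      ∑[ y ← allFin m ] (hits s y * hits t y)  ≤⟨ ∑-mono-≤ (allFin m) (λ {y} _ → indicator-*-≤ (common y)) ⟩
      ∑[ y ← allFin m ] (col s t * hits s y)  ≡⟨ ∑-*ˡ (allFin m) (col s t) (hits s) ⟩
      col s t * ∑[ y ← allFin m ] hits s y    ≡⟨ cong (col s t *_) (∑-hits s) ⟩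
      col s t * ℕ→ℚ i                        ∎
      where
      open ℚP.≤-Reasoning
      common : ∀ y → T (mem y (take i (proj₁ (proj₁ s)))) → T (mem y (take i (proj₁ (proj₁ t)))) →
               T (collides (proj₁ s) i (proj₁ t) j)
      common y y∈s y∈t = collides⁺ {σ = proj₁ s} {τ = proj₁ t} {i} {j}
                           (mem⁻ y∈s) (∈-take-mono (proj₁ (proj₁ t)) i≤j (mem⁻ y∈t))

    ∑-load²≤ : ∑[ y ← allFin m ] (load y * load y) ≤ collisionProb A i j * ℕ→ℚ i
    ∑-load²≤ = begin
      ∑[ y ← allFin m ] (load y * load y)                                          ≡⟨ ∑-load² ⟩
      ∑[ s ← support A ] ∑[ t ← support A ] (weight s * weight t * shared s t)
        ≤⟨ ∑-mono-≤ (support A) (λ {s} s∈ → ∑-mono-≤ (support A) (λ {t} t∈ →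
             *-monoˡ-≤-0≤ (*-nonNeg (All.lookup (nonneg A) s∈) (All.lookup (nonneg A) t∈)) (shared≤ s t))) ⟩
      ∑[ s ← support A ] ∑[ t ← support A ] (weight s * weight t * (col s t * ℕ→ℚ i))
        ≡⟨ ∑-cong (support A) (λ s → trans
             (∑-cong (support A) (λ t → sym (ℚP.*-assoc (weight s * weight t) (col s t) (ℕ→ℚ i))))
             (∑-*ʳ (support A) (ℕ→ℚ i) (λ t → weight s * weight t * col s t))) ⟩
      ∑[ s ← support A ] (∑[ t ← support A ] (weight s * weight t * col s t) * ℕ→ℚ i)
        ≡⟨ ∑-*ʳ (support A) (ℕ→ℚ i) _ ⟩
      (∑[ s ← support A ] ∑[ t ← support A ] (weight s * weight t * col s t)) * ℕ→ℚ i
        ≡⟨ cong (_* ℕ→ℚ i) (collisionProb-∑ A i j) ⟨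
      collisionProb A i j * ℕ→ℚ i                                                  ∎
      where open ℚP.≤-Reasoning

    i*i≤i*m*P : ℕ→ℚ i * ℕ→ℚ i ≤ ℕ→ℚ i * (ℕ→ℚ m * collisionProb A i j)
    i*i≤i*m*P = begin
      ℕ→ℚ i * ℕ→ℚ i                                       ≡⟨ cong₂ _*_ ∑-load ∑-load ⟨
      ∑ (allFin m) load * ∑ (allFin m) load               ≤⟨ ∑-square≤length*∑-squares (allFin m) load ⟩
      ℕ→ℚ (length (allFin m)) * ∑[ y ← allFin m ] (load y * load y)
                                                           ≡⟨ cong (λ n → ℕ→ℚ n * ∑[ y ← allFin m ] (load y * load y)) (length-allFin m) ⟩
      ℕ→ℚ m * ∑[ y ← allFin m ] (load y * load y)         ≤⟨ *-monoˡ-≤-0≤ (ℕ→ℚ-nonNeg m) ∑-load²≤ ⟩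
      ℕ→ℚ m * (collisionProb A i j * ℕ→ℚ i)               ≡⟨ rotate (ℕ→ℚ m) (collisionProb A i j) (ℕ→ℚ i) ⟩
      ℕ→ℚ i * (ℕ→ℚ m * collisionProb A i j)               ∎
      where
      open ℚP.≤-Reasoning
      open ℚSolver.+-*-Solver
      rotate : ∀ a b c → a * (b * c) ≡ c * (a * b)
      rotate = solve 3 (λ a b c → a :* (b :* c) := c :* (a :* b)) refl

  lower-bound : ∀ {m i j} .{{_ : NonZero i}} → i ℕ.≤ j → i ℕ.≤ m → (A : Algorithm m) →
                ℕ→ℚ i ≤ ℕ→ℚ m * collisionProb A i j
  lower-bound {i = i} i≤j i≤m A =
    ℚP.*-cancelˡ-≤-pos (ℕ→ℚ i) {{ℕ→ℚ-pos i}} (LowerBound.i*i≤i*m*P A i≤j i≤m)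

  -- The upper bound

  range : ℕ → ℕ → List ℕ
  range a zero    = []
  range a (suc n) = a ∷ range (suc a) n

  length-range : ∀ a n → length (range a n) ≡ n
  length-range a zero    = refl
  length-range a (suc n) = cong suc (length-range (suc a) n)

  range-++ : ∀ a n₁ n₂ → range a (n₁ ℕ.+ n₂) ≡ range a n₁ ++ range (a ℕ.+ n₁) n₂
  range-++ a zero     n₂ = cong (λ b → range b n₂) (sym (ℕP.+-identityʳ a))
  range-++ a (suc n₁) n₂ = cong (a ∷_) (trans (range-++ (suc a) n₁ n₂)
                                              (cong (λ b → range (suc a) n₁ ++ range b n₂) (sym (ℕP.+-suc a n₁))))

  ∈-range⁻ : ∀ {x} a n → x ∈ range a n → a ℕ.≤ x × x ℕ.< a ℕ.+ n
  ∈-range⁻     a (suc n) (here refl)  = ℕP.≤-refl , ℕP.m<m+n a (s≤s z≤n)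
  ∈-range⁻ {x} a (suc n) (there x∈) with a<x , x<1+a+n ← ∈-range⁻ (suc a) n x∈ =
    ℕP.<⇒≤ a<x , subst (x ℕ.<_) (sym (ℕP.+-suc a n)) x<1+a+n

  tabulate-toℕ≡range : ∀ n a → tabulate (λ (x : Fin n) → a ℕ.+ toℕ x) ≡ range a n
  tabulate-toℕ≡range zero    a = refl
  tabulate-toℕ≡range (suc n) a = cong₂ _∷_ (ℕP.+-identityʳ a)
    (trans (List.tabulate-cong (λ x → ℕP.+-suc a (toℕ x))) (tabulate-toℕ≡range n (suc a)))

  interval : ℕ → ℕ → List ℕ
  interval a e = range a (e ∸ a)

  interval-++ : ∀ {a b c} → a ℕ.≤ b → b ℕ.≤ c → interval a c ≡ interval a b ++ interval b c
  interval-++ {a} {b} {c} a≤b b≤c = begin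
    range a (c ∸ a)                               ≡⟨ cong (range a) lengths ⟨
    range a ((b ∸ a) ℕ.+ (c ∸ b))                 ≡⟨ range-++ a (b ∸ a) (c ∸ b) ⟩
    range a (b ∸ a) ++ range (a ℕ.+ (b ∸ a)) (c ∸ b) ≡⟨ cong (λ x → range a (b ∸ a) ++ range x (c ∸ b)) (ℕP.m+[n∸m]≡n a≤b) ⟩
    range a (b ∸ a) ++ range b (c ∸ b)            ∎
    where
    open ≡-Reasoning
    lengths : (b ∸ a) ℕ.+ (c ∸ b) ≡ c ∸ a
    lengths = trans (ℕP.+-comm (b ∸ a) (c ∸ b))
                    (trans (sym (ℕP.+-∸-assoc (c ∸ b) a≤b)) (cong (_∸ a) (ℕP.m∸n+n≡m b≤c)))

  ∈-interval⁻ : ∀ {x a e} → a ℕ.≤ e → x ∈ interval a e → a ℕ.≤ x × x ℕ.< e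
  ∈-interval⁻ {x} {a} {e} a≤e x∈ with a≤x , x<a+[e∸a] ← ∈-range⁻ a (e ∸ a) x∈ =
    a≤x , subst (x ℕ.<_) (ℕP.m+[n∸m]≡n a≤e) x<a+[e∸a]

  module Uniform {m K : ℕ} .{{_ : NonZero K}} (σ : Fin K → Perm m) where

    private instance
      K≢0 : ℚ.NonZero (ℕ→ℚ K)
      K≢0 = ℚP.pos⇒nonZero (ℕ→ℚ K) {{ℕ→ℚ-pos K}}

    w : ℚ
    w = ℚ.1/ ℕ→ℚ K

    0≤w : 0ℚ ≤ w
    0≤w = ℚP.<⇒≤ (ℚP.positive⁻¹ w {{ℚP.1/pos⇒pos (ℕ→ℚ K) {{ℕ→ℚ-pos K}}}})

    K*w≡1 : ℕ→ℚ K * w ≡ 1ℚ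
    K*w≡1 = ℚP.*-inverseʳ (ℕ→ℚ K)

    weighted : Fin K → Perm m × ℚ
    weighted b = σ b , w

    uniform : Algorithm m
    uniform = record
      { support = map weighted (allFin K)
      ; nonneg  = All.map⁺ (All.universal (λ _ → 0≤w) (allFin K))
      ; total   = trans (∑-map (allFin K) weighted proj₂) (trans (∑-allFin-const K w) K*w≡1)
      }

    collisionProb-uniform≤ : ∀ {i j} → (∀ b c → T (collides (σ b) i (σ c) j) → b ≡ c) →
                             collisionProb uniform i j ≤ w
    collisionProb-uniform≤ {i} {j} collides⇒≡ = begin
      collisionProb uniform i j
        ≡⟨ trans (collisionProb-∑ uniform i j) (trans (∑-map (allFin K) weighted _)
             (∑-cong (allFin K) (λ b → ∑-map (allFin K) weighted _))) ⟩
      ∑[ b ← allFin K ] ∑[ c ← allFin K ] (w * w * indicator (collides (σ b) i (σ c) j))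
        ≤⟨ ∑-mono-≤ (allFin K) (λ {b} _ → ∑-mono-≤ (allFin K) (λ {c} _ →
             *-monoˡ-≤-0≤ (*-nonNeg 0≤w 0≤w)
               (indicator-mono {b = ⌊ c ≟ b ⌋} (λ col → fromWitness (sym (collides⇒≡ b c col)))))) ⟩
      ∑[ b ← allFin K ] ∑[ c ← allFin K ] (w * w * indicator ⌊ c ≟ b ⌋)
        ≡⟨ ∑-cong (allFin K) (λ b → trans (∑-*ˡ (allFin K) (w * w) (λ c → indicator ⌊ c ≟ b ⌋))
                                          (cong (w * w *_) (∑-indicator-≟ b))) ⟩
      ∑[ b ← allFin K ] (w * w * 1ℚ)        ≡⟨ ∑-allFin-const K (w * w * 1ℚ) ⟩
      ℕ→ℚ K * (w * w * 1ℚ)                  ≡⟨ cong (ℕ→ℚ K *_) (ℚP.*-identityʳ (w * w)) ⟩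
      ℕ→ℚ K * (w * w)                       ≡⟨ ℚP.*-assoc (ℕ→ℚ K) w w ⟨
      ℕ→ℚ K * w * w                         ≡⟨ cong (_* w) K*w≡1 ⟩
      1ℚ * w                                ≡⟨ ℚP.*-identityˡ w ⟩
      w                                     ∎
      where open ℚP.≤-Reasoning

  ≤-block⇒≤ : ∀ {i} p q {a} → p ℕ.* i ℕ.≤ a → a ℕ.< q ℕ.* i ℕ.+ i → p ℕ.≤ q
  ≤-block⇒≤ {i} p q {a} p*i≤a a<q*i+i = ℕP.<⇒≤pred {p} {suc q} (ℕP.*-cancelʳ-< i p (suc q)
    (ℕP.≤-<-trans p*i≤a (subst (a ℕ.<_) (ℕP.+-comm (q ℕ.* i) i) a<q*i+i)))

  ↭-rearrange : ∀ {A : Set} (ws xs ys zs : List A) → xs ++ zs ++ ws ++ ys ↭ ws ++ xs ++ ys ++ zs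
  ↭-rearrange ws xs ys zs = ↭-trans (↭.++⁺ˡ xs (↭-trans (↭.++-comm zs (ws ++ ys))
                                                          (↭-reflexive (List.++-assoc ws ys zs))))
                                      (↭.shifts xs ws)

  module Blocks {m i j K : ℕ} .{{_ : NonZero m}} (i≤j : i ℕ.≤ j) (K*i+j≤m : K ℕ.* i ℕ.+ j ℕ.≤ m) where

    toFin : ℕ → Fin m
    toFin a = a mod m

    toℕ-toFin : ∀ {a} → a ℕ.< m → toℕ (toFin a) ≡ a
    toℕ-toFin a<m = trans (toℕ-fromℕ< _) (m<n⇒m%n≡m a<m)

    map-toFin-interval : map toFin (interval 0 m) ≡ allFin m
    map-toFin-interval = begin
      map toFin (range 0 m)         ≡⟨ cong (map toFin) (tabulate-toℕ≡range m 0) ⟨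
      map toFin (tabulate toℕ)      ≡⟨ List.map-tabulate toℕ toFin ⟩
      tabulate (toFin ∘ toℕ)        ≡⟨ List.tabulate-cong (λ x → toℕ-injective (toℕ-toFin (toℕ<n x))) ⟩
      tabulate id                   ∎
      where open ≡-Reasoning

    toFin-∈-interval : ∀ {lo hi a} → lo ℕ.≤ hi → hi ℕ.≤ m → a ∈ interval lo hi →
                       lo ℕ.≤ toℕ (toFin a) × toℕ (toFin a) ℕ.< hi
    toFin-∈-interval lo≤hi hi≤m a∈ with lo≤a , a<hi ← ∈-interval⁻ lo≤hi a∈
      rewrite toℕ-toFin (ℕP.<-≤-trans a<hi hi≤m) = lo≤a , a<hi

    Ki : ℕ
    Ki = K ℕ.* i

    start end : Fin K → ℕ
    start b = toℕ b ℕ.* i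
    end b = start b ℕ.+ i

    start≤end : ∀ b → start b ℕ.≤ end b
    start≤end b = ℕP.m≤m+n (start b) i

    end≤Ki : ∀ b → end b ℕ.≤ Ki
    end≤Ki b = subst (ℕ._≤ Ki) (ℕP.+-comm i (start b)) (ℕP.*-monoˡ-≤ i (toℕ<n b))

    Ki≤m : Ki ℕ.≤ m
    Ki≤m = ℕP.m+n≤o⇒m≤o Ki K*i+j≤m

    block : Fin K → List ℕ
    block b = interval (start b) (end b)

    tail : List ℕ
    tail = interval Ki m

    layout : Fin K → List ℕ
    layout b = block b ++ tail ++ interval 0 (start b) ++ interval (end b) Ki

    layout↭interval : ∀ b → layout b ↭ interval 0 m
    layout↭interval b = ↭-trans (↭-rearrange (interval 0 (start b)) (block b) (interval (end b) Ki) tail)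
                                 (↭-reflexive (sym split))
      where
      split : interval 0 m ≡ interval 0 (start b) ++ block b ++ interval (end b) Ki ++ tail
      split = trans (interval-++ z≤n (ℕP.≤-trans (start≤end b) (ℕP.≤-trans (end≤Ki b) Ki≤m)))
                (cong (interval 0 (start b) ++_) (trans (interval-++ (start≤end b) (ℕP.≤-trans (end≤Ki b) Ki≤m))
                  (cong (block b ++_) (interval-++ (end≤Ki b) Ki≤m))))

    blockPerm : Fin K → Perm m
    blockPerm b = map toFin (layout b) , ↭-trans (↭.map⁺ toFin (layout↭interval b)) (↭-reflexive map-toFin-interval)

    ∈-take-blockPerm⁻ : ∀ {n x} b → x ∈ take n (proj₁ (blockPerm b)) → ∃ λ a → a ∈ take n (layout b) × x ≡ toFin a
    ∈-take-blockPerm⁻ {n} b x∈ = ∈-map⁻ toFin (subst (_ ∈_) (List.take-map n (layout b)) x∈)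

    length-block : ∀ b → length (block b) ≡ i
    length-block b = trans (length-range (start b) (end b ∸ start b)) (ℕP.m+n∸m≡n (start b) i)

    j≤length-block++tail : ∀ b → j ℕ.≤ length (block b ++ tail)
    j≤length-block++tail b = begin
      j                                   ≡⟨ ℕP.m+n∸m≡n Ki j ⟨
      Ki ℕ.+ j ∸ Ki                       ≤⟨ ℕP.∸-monoˡ-≤ Ki K*i+j≤m ⟩
      m ∸ Ki                              ≤⟨ ℕP.m≤n+m (m ∸ Ki) i ⟩
      i ℕ.+ (m ∸ Ki)                      ≡⟨ cong₂ ℕ._+_ (length-block b) (length-range Ki (m ∸ Ki)) ⟨
      length (block b) ℕ.+ length tail    ≡⟨ List.length-++ (block b) ⟨
      length (block b ++ tail)            ∎
      where open ℕP.≤-Reasoning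

    take-i-in-block : ∀ b {x} → x ∈ take i (proj₁ (blockPerm b)) → start b ℕ.≤ toℕ x × toℕ x ℕ.< end b
    take-i-in-block b x∈ with a , a∈ , refl ← ∈-take-blockPerm⁻ b x∈ =
      toFin-∈-interval (start≤end b) (ℕP.≤-trans (end≤Ki b) Ki≤m)
        (∈-take-++⁻ (block b) _ (ℕP.≤-reflexive (sym (length-block b))) a∈)

    take-j-in-block-or-tail : ∀ b {x} → x ∈ take j (proj₁ (blockPerm b)) →
                              (start b ℕ.≤ toℕ x × toℕ x ℕ.< end b) ⊎ Ki ℕ.≤ toℕ x
    take-j-in-block-or-tail b x∈ with a , a∈ , refl ← ∈-take-blockPerm⁻ b x∈
      with ∈-++⁻ (block b) (∈-take-++⁻ (block b ++ tail) _ (j≤length-block++tail b)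
                              (subst (λ xs → a ∈ take j xs) (sym (List.++-assoc (block b) tail _)) a∈))
    ... | inj₁ a∈block = inj₁ (toFin-∈-interval (start≤end b) (ℕP.≤-trans (end≤Ki b) Ki≤m) a∈block)
    ... | inj₂ a∈tail  = inj₂ (proj₁ (toFin-∈-interval Ki≤m ℕP.≤-refl a∈tail))

    blockPerm-collides⇒≡ : ∀ b c → T (collides (blockPerm b) i (blockPerm c) j) → b ≡ c
    blockPerm-collides⇒≡ b c col
      with x , x∈b , x∈c ← collides⁻ {σ = blockPerm b} {τ = blockPerm c} {i} {j} col
      with start≤x , x<end ← take-i-in-block b x∈b | take-j-in-block-or-tail c x∈c
    ... | inj₁ (start′≤x , x<end′) = toℕ-injective (ℕP.≤-antisym (≤-block⇒≤ (toℕ b) (toℕ c) start≤x x<end′)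
                                                                 (≤-block⇒≤ (toℕ c) (toℕ b) start′≤x x<end))
    ... | inj₂ Ki≤x = ⊥-elim (ℕP.<⇒≱ (ℕP.<-≤-trans x<end (end≤Ki b)) Ki≤x)

  module BlockCount {m i j : ℕ} .{{_ : NonZero i}} (i≤j : i ℕ.≤ j) (2j≤m : 2 ℕ.* j ℕ.≤ m) where

    K : ℕ
    K = (m ∸ j) ℕ./ i

    j≤m : j ℕ.≤ m
    j≤m = ℕP.≤-trans (ℕP.m≤m+n j (j ℕ.+ 0)) 2j≤m

    i≤m : i ℕ.≤ m
    i≤m = ℕP.≤-trans i≤j j≤m

    j≤m∸j : j ℕ.≤ m ∸ j
    j≤m∸j = subst (ℕ._≤ m ∸ j) (trans (ℕP.m+n∸m≡n j (j ℕ.+ 0)) (ℕP.+-identityʳ j)) (ℕP.∸-monoˡ-≤ j 2j≤m)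

    m∸j≡r+K*i : m ∸ j ≡ (m ∸ j) ℕ.% i ℕ.+ K ℕ.* i
    m∸j≡r+K*i = m≡m%n+[m/n]*n (m ∸ j) i

    -- Since m ∸ j ≥ j ≥ i exceeds the remainder modulo i, at least one block fits.
    1≤K : 1 ℕ.≤ K
    1≤K = ℕP.n≢0⇒n>0 λ K≡0 → ℕP.<⇒≱ (m%n<n (m ∸ j) i) (begin
      i                            ≤⟨ ℕP.≤-trans i≤j j≤m∸j ⟩
      m ∸ j                        ≡⟨ m∸j≡r+K*i ⟩
      (m ∸ j) ℕ.% i ℕ.+ K ℕ.* i    ≡⟨ cong (λ k → (m ∸ j) ℕ.% i ℕ.+ k ℕ.* i) K≡0 ⟩
      (m ∸ j) ℕ.% i ℕ.+ 0          ≡⟨ ℕP.+-identityʳ _ ⟩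
      (m ∸ j) ℕ.% i                ∎)
      where open ℕP.≤-Reasoning

    K-nonZero : NonZero K
    K-nonZero = ℕ.>-nonZero 1≤K

    K*i+j≤m : K ℕ.* i ℕ.+ j ℕ.≤ m
    K*i+j≤m = subst (K ℕ.* i ℕ.+ j ℕ.≤_) (ℕP.m∸n+n≡m j≤m) (ℕP.+-monoˡ-≤ j (m/n*n≤m (m ∸ j) i))

    m≤4*K*i : m ℕ.≤ 4 ℕ.* (K ℕ.* i)
    m≤4*K*i = begin
      m                                     ≡⟨ ℕP.m∸n+n≡m j≤m ⟨
      (m ∸ j) ℕ.+ j                         ≤⟨ ℕP.+-monoʳ-≤ (m ∸ j) j≤m∸j ⟩
      (m ∸ j) ℕ.+ (m ∸ j)                   ≤⟨ ℕP.+-mono-≤ m∸j≤2Ki m∸j≤2Ki ⟩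
      (K ℕ.* i ℕ.+ K ℕ.* i) ℕ.+ (K ℕ.* i ℕ.+ K ℕ.* i) ≡⟨ four (K ℕ.* i) ⟩
      4 ℕ.* (K ℕ.* i)                       ∎
      where
      open ℕP.≤-Reasoning
      i≤K*i : i ℕ.≤ K ℕ.* i
      i≤K*i = subst (ℕ._≤ K ℕ.* i) (ℕP.*-identityˡ i) (ℕP.*-monoˡ-≤ i 1≤K)
      m∸j≤2Ki : m ∸ j ℕ.≤ K ℕ.* i ℕ.+ K ℕ.* i
      m∸j≤2Ki = subst (ℕ._≤ K ℕ.* i ℕ.+ K ℕ.* i) (sym m∸j≡r+K*i)
        (ℕP.+-monoˡ-≤ (K ℕ.* i) (ℕP.≤-trans (ℕP.<⇒≤ (m%n<n (m ∸ j) i)) i≤K*i))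
      open ℕSolver.+-*-Solver
      four : ∀ x → (x ℕ.+ x) ℕ.+ (x ℕ.+ x) ≡ 4 ℕ.* x
      four = solve 1 (λ x → (x :+ x) :+ (x :+ x) := con 4 :* x) refl

  upper-bound : ∀ {m i j} .{{_ : NonZero i}} → i ℕ.≤ j → 2 ℕ.* j ℕ.≤ m →
                Σ (Algorithm m) λ A → ℕ→ℚ m * collisionProb A i j ≤ ℕ→ℚ 4 * ℕ→ℚ i
  upper-bound {m} {i} {j} i≤j 2j≤m = uniform , (begin
    ℕ→ℚ m * collisionProb uniform i j   ≤⟨ *-monoˡ-≤-0≤ (ℕ→ℚ-nonNeg m) (collisionProb-uniform≤ {i} {j} blockPerm-collides⇒≡) ⟩
    ℕ→ℚ m * w                          ≤⟨ ℚP.*-monoʳ-≤-nonNeg w {{ℚ.nonNegative 0≤w}} (ℕ→ℚ-mono-≤ m≤4*K*i) ⟩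
    ℕ→ℚ (4 ℕ.* (K ℕ.* i)) * w          ≡⟨ cong (_* w) (trans (ℕ→ℚ-* 4 (K ℕ.* i)) (cong (ℕ→ℚ 4 *_) (ℕ→ℚ-* K i))) ⟩
    ℕ→ℚ 4 * (ℕ→ℚ K * ℕ→ℚ i) * w        ≡⟨ regroup (ℕ→ℚ 4) (ℕ→ℚ K) (ℕ→ℚ i) w ⟩
    ℕ→ℚ 4 * ℕ→ℚ i * (ℕ→ℚ K * w)        ≡⟨ cong (ℕ→ℚ 4 * ℕ→ℚ i *_) K*w≡1 ⟩
    ℕ→ℚ 4 * ℕ→ℚ i * 1ℚ                 ≡⟨ ℚP.*-identityʳ (ℕ→ℚ 4 * ℕ→ℚ i) ⟩
    ℕ→ℚ 4 * ℕ→ℚ i                      ∎)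
    where
    open BlockCount i≤j 2j≤m
    instance
      _ : NonZero K
      _ = K-nonZero
      _ : NonZero m
      _ = ℕ.>-nonZero (ℕP.<-≤-trans (ℕP.n≢0⇒n>0 (ℕ.≢-nonZero⁻¹ i)) i≤m)
    open Blocks {K = K} i≤j K*i+j≤m
    open Uniform blockPerm
    open ℚP.≤-Reasoning
    open ℚSolver.+-*-Solver
    regroup : ∀ a k b w → a * (k * b) * w ≡ a * b * (k * w)
    regroup = solve 4 (λ a k b w → a :* (k :* b) :* w := a :* b :* (k :* w)) refl

open import Defs
open import Data.Nat using (ℕ; _≤_; suc)
open import Data.Product using (Σ; _×_; _,_)
open import Data.Rational using (ℚ; 0ℚ; 1ℚ; _<_; _*_)
import Data.Rational.Properties as ℚP
open import Relation.Binary.PropositionalEquality using (subst; sym)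
open CollisionBounds using (ℕ→ℚ-pos; lower-bound; upper-bound; module BlockCount)

lemma8p2 : Σ ℚ λ c → Σ ℚ λ C → (0ℚ < c) × (0ℚ < C) ×
    ((m i j : ℕ) → 1 ≤ i → i ≤ j → 2 Data.Nat.* j ≤ m →
      ((A : Algorithm m) →
        (c * ℕ→ℚ i) Data.Rational.≤ (ℕ→ℚ m * collisionProb A i j))
      × (Σ (Algorithm m) λ A →
        (ℕ→ℚ m * collisionProb A i j) Data.Rational.≤ (C * ℕ→ℚ i)))
lemma8p2 = 1ℚ , ℕ→ℚ 4 , ℚP.positive⁻¹ 1ℚ , ℚP.positive⁻¹ (ℕ→ℚ 4) {{ℕ→ℚ-pos 4}} , bounds
  where
  bounds : (m i j : ℕ) → 1 ≤ i → i ≤ j → 2 Data.Nat.* j ≤ m →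
           ((A : Algorithm m) → (1ℚ * ℕ→ℚ i) Data.Rational.≤ (ℕ→ℚ m * collisionProb A i j))
           × (Σ (Algorithm m) λ A → (ℕ→ℚ m * collisionProb A i j) Data.Rational.≤ (ℕ→ℚ 4 * ℕ→ℚ i))
  bounds m (suc i) j _ i≤j 2j≤m =
    (λ A → subst (Data.Rational._≤ ℕ→ℚ m * collisionProb A (suc i) j) (sym (ℚP.*-identityˡ (ℕ→ℚ (suc i))))
                 (lower-bound i≤j (BlockCount.i≤m i≤j 2j≤m) A))
    , upper-bound i≤j 2j≤m
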